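{- Let $G$ be a planar graph with at least one vertex and girth at least $5$. Then $G$ contains at least one of the following configurations: (C1.1) a vertex $x$ of degree at most $1$; (C1.2) a vertex $x$ of degree $2$ adjacent to a vertex $y$ of degree at most $6$; (C1.3) a vertex $x$ of degree $3$ adjacent to a vertex $y$ of degree at most $4$ and to a vertex $z\ne y$ of degree at most $6$; (C1.4) a vertex $x$ of degree $i$, for some $i\in\{7,8,9\}$, adjacent to at least $i-1$ vertices of degree $2$.
   Context: The girth of a graph is the length of a shortest cycle (infinite for forests). -}

module Defs where

open import Data.Nat using (ℕ; zero; suc; _+_; _*_; _∸_; _≤_; _≤ᵇ_; _<ᵇ_; _≡ᵇ_)
open import Data.Bool using (Bool; true; false; _∧_; _∨_; not; if_then_else_)
open import Data.Fin using (Fin; toℕ)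
open import Data.Product using (Σ; ∃; _×_; _,_; proj₁; proj₂)
open import Data.Sum using (_⊎_)
open import Relation.Binary.PropositionalEquality using (_≡_; _≢_)
open import Function.Definitions using (Injective)

record Graph : Set where
  field
    n          : ℕ
    adj        : Fin n → Fin n → Bool
    adj-sym    : ∀ x y → adj x y ≡ adj y x
    adj-irrefl : ∀ x → adj x x ≡ false

open Graph public

Vertex : Graph → Set
Vertex G = Fin (n G)

Edge : (G : Graph) → Vertex G → Vertex G → Set
Edge G x y = adj G x y ≡ true

count : ∀ {k} → (Fin k → Bool) → ℕ
count {zero}  f = 0
count {suc k} f = (if f Fin.zero then 1 else 0) + count (λ i → f (Fin.suc i))

sumF : ∀ {k} → (Fin k → ℕ) → ℕ
sumF {zero}  f = 0
sumF {suc k} f = f Fin.zero + sumF (λ i → f (Fin.suc i))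

anyF : ∀ {k} → (Fin k → Bool) → Bool
anyF {zero}  f = false
anyF {suc k} f = f Fin.zero ∨ anyF (λ i → f (Fin.suc i))

allF : ∀ {k} → (Fin k → Bool) → Bool
allF {zero}  f = true
allF {suc k} f = f Fin.zero ∧ allF (λ i → f (Fin.suc i))

allBelow : ℕ → (ℕ → Bool) → Bool
allBelow zero    p = true
allBelow (suc N) p = allBelow N p ∧ p N

iter : ∀ {A : Set} → (A → A) → ℕ → A → A
iter f zero    a = a
iter f (suc k) a = f (iter f k a)

degree : (G : Graph) → Vertex G → ℕ
degree G x = count (adj G x)

#edges : Graph → ℕ
#edges G = sumF (λ x → count (λ y → adj G x y ∧ (toℕ x <ᵇ toℕ y)))

#isolated : Graph → ℕ
#isolated G = count (λ x → degree G x ≡ᵇ 0)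

eqF : ∀ {k} → Fin k → Fin k → Bool
eqF x y = toℕ x ≡ᵇ toℕ y

reachW : (G : Graph) → ℕ → Vertex G → Vertex G → Bool
reachW G zero    v u = eqF v u
reachW G (suc k) v u = reachW G k v u ∨ anyF (λ w → reachW G k v w ∧ adj G w u)

reachable : (G : Graph) → Vertex G → Vertex G → Bool
reachable G = reachW G (n G)

-- number of connected components = number of vertices that are the
-- least vertex of their component
#components : Graph → ℕ
#components G =
  count (λ v → allF (λ u → not (reachable G v u) ∨ (toℕ v ≤ᵇ toℕ u)))

record IsCycle (G : Graph) (k : ℕ) (f : Fin k → Vertex G) : Set where
  field
    length≥3  : 3 ≤ k
    injective : Injective _≡_ _≡_ f
    step      : ∀ i j → suc (toℕ i) ≡ toℕ j → Edge G (f i) (f j)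
    close     : ∀ i j → suc (toℕ i) ≡ k → toℕ j ≡ 0 → Edge G (f i) (f j)

GirthAtLeast5 : Graph → Set
GirthAtLeast5 G = ∀ k (f : Fin k → Vertex G) → IsCycle G k f → 5 ≤ k

-- Planarity via combinatorial embeddings (rotation systems).
-- rot x : cyclic permutation of the neighbours of x.

record RotationSystem (G : Graph) : Set where
  field
    rot     : Vertex G → Vertex G → Vertex G
    rot-adj : ∀ x y → Edge G x y → Edge G x (rot x y)
    rot-inj : ∀ x y z → Edge G x y → Edge G x z → rot x y ≡ rot x z → y ≡ z
    rot-cyc : ∀ x y z → Edge G x y → Edge G x z →
              ∃ λ k → iter (rot x) k y ≡ z

module _ {G : Graph} (ρ : RotationSystem G) where
  open RotationSystem ρ

  -- face-tracing permutation on darts (x , y)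
  faceStep : Vertex G × Vertex G → Vertex G × Vertex G
  faceStep (x , y) = (y , rot y x)

  dartCode : Vertex G × Vertex G → ℕ
  dartCode (x , y) = toℕ x * n G + toℕ y

  isFaceRep : Vertex G × Vertex G → Bool
  isFaceRep d = adj G (proj₁ d) (proj₂ d) ∧
    allBelow (n G * n G) (λ k → dartCode d ≤ᵇ dartCode (iter faceStep k d))

  -- number of faces = number of faceStep-orbits on darts
  #faces : ℕ
  #faces = sumF (λ x → count (λ y → isFaceRep (x , y)))

-- The embedding given by ρ has genus 0 on every component, i.e. Euler's
-- formula V - E + F = 2 holds on each non-trivial component (an isolated
-- vertex has no darts, contributing 1 - 0 + 0, hence the #isolated term).
-- Since V - E + F ≤ 2 on each component, the summed identity
--   V - E + F + #isolated = 2 * #components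
-- is equivalent to genus 0 on every component.
IsPlanarEmbedding : (G : Graph) → RotationSystem G → Set
IsPlanarEmbedding G ρ = n G + #faces ρ + #isolated G ≡ #edges G + 2 * #components G

Planar : Graph → Set
Planar G = Σ (RotationSystem G) (IsPlanarEmbedding G)

C1-1 : Graph → Set
C1-1 G = ∃ λ (x : Vertex G) → degree G x ≤ 1

C1-2 : Graph → Set
C1-2 G = ∃ λ (x : Vertex G) → ∃ λ (y : Vertex G) →
  degree G x ≡ 2 × Edge G x y × degree G y ≤ 6

C1-3 : Graph → Set
C1-3 G = ∃ λ (x : Vertex G) → ∃ λ (y : Vertex G) → ∃ λ (z : Vertex G) →
  degree G x ≡ 3 × Edge G x y × degree G y ≤ 4 ×
  Edge G x z × z ≢ y × degree G z ≤ 6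

#deg2Neighbours : (G : Graph) → Vertex G → ℕ
#deg2Neighbours G x = count (λ y → adj G x y ∧ (degree G y ≡ᵇ 2))

C1-4 : Graph → Set
C1-4 G = ∃ λ (x : Vertex G) → ∃ λ (i : ℕ) →
  7 ≤ i × i ≤ 9 × degree G x ≡ i × i ∸ 1 ≤ #deg2Neighbours G x

{-# OPTIONS --safe #-}
module Submission where

-- Suppose no configuration occurs; then every vertex has degree at least 2.  Give
-- a vertex of degree d the charge 3d - 10 and let a vertex of degree at least 7
-- send 2 to each neighbour of degree 2 and 1/2 to each neighbour of degree 3, and
-- a vertex of degree 5 or 6 send 1/3 to each neighbour of degree 3.  The absence
-- of the configurations makes every final charge nonnegative, so summing gives
-- 5n <= 3E.  A face is an orbit of darts under the face-tracing permutation; as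
-- the rotation at a vertex of degree at least 2 has no fixed point, the boundary
-- walk of a face of length at most 4 would be a cycle of length at most 4, so
-- girth at least 5 gives 5F <= 2E.  Euler's formula n + F >= E + 2 then yields
-- 5E + 10 <= 5n + 5F <= 5E.

open import Defs
open import Data.Nat using (ℕ; zero; suc; _+_; _*_; _∸_; _≤_; _<_; z≤n; s≤s; _≤?_; _≤ᵇ_; _<ᵇ_; _≡ᵇ_)
open import Data.Nat.Properties
open import Data.Nat.Tactic.RingSolver using (solve-∀)
open import Data.Bool using (Bool; true; false; _∧_; _∨_; not; if_then_else_)
open import Data.Bool.Properties using (T-≡; ∧-identityʳ; ∧-conicalˡ; ∧-conicalʳ; ∨-zeroʳ)
open import Data.Fin as F using (Fin; toℕ; combine; remQuot; _↑ˡ_; _↑ʳ_)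
open import Data.Fin.Properties
  using (toℕ-injective; toℕ<n; toℕ-fromℕ<; toℕ-combine; combine-injective; remQuot-combine; combine-remQuot; pigeonhole)
  renaming (suc-injective to F-suc-injective)
open import Data.Product using (∃; _×_; _,_; proj₁; proj₂; uncurry)
open import Data.Sum using (_⊎_; inj₁; inj₂)
open import Data.Empty using (⊥; ⊥-elim)
open import Function using (_∘_)
open import Function.Bundles using (Equivalence)
open import Relation.Nullary using (yes; no)
open import Relation.Binary.PropositionalEquality
open import Relation.Binary.Definitions using (tri<; tri≈; tri>)
open import Algebra.Properties.CommutativeMonoid.Sum +-0-commutativeMonoid using (sum; sum-cong-≗; ∑-distrib-+; ∑-comm)
open import Algebra.Properties.Semiring.Sum +-*-semiring using (*-distribˡ-sum)

∀⊎ : ∀ {k} {A : Set} {B : Fin k → Set} → (∀ i → A ⊎ B i) → A ⊎ (∀ i → B i)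
∀⊎ {zero}  h = inj₂ (λ ())
∀⊎ {suc k} h with h F.zero | ∀⊎ (λ i → h (F.suc i))
... | inj₁ a | _       = inj₁ a
... | inj₂ _ | inj₁ a  = inj₁ a
... | inj₂ b | inj₂ bs = inj₂ λ { F.zero → b ; (F.suc i) → bs i }

sumF≡sum : ∀ {k} (f : Fin k → ℕ) → sumF f ≡ sum f
sumF≡sum {zero}  f = refl
sumF≡sum {suc k} f = cong (f F.zero +_) (sumF≡sum (λ i → f (F.suc i)))

sumF-cong : ∀ {k} {f g : Fin k → ℕ} → (∀ i → f i ≡ g i) → sumF f ≡ sumF g
sumF-cong {zero}  f≗g = refl
sumF-cong {suc k} f≗g = cong₂ _+_ (f≗g F.zero) (sumF-cong (λ i → f≗g (F.suc i)))

sumF-mono : ∀ {k} {f g : Fin k → ℕ} → (∀ i → f i ≤ g i) → sumF f ≤ sumF g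
sumF-mono {zero}  f≤g = z≤n
sumF-mono {suc k} f≤g = +-mono-≤ (f≤g F.zero) (sumF-mono (λ i → f≤g (F.suc i)))

sumF-const : ∀ {k} c → sumF {k} (λ _ → c) ≡ k * c
sumF-const {zero}  c = refl
sumF-const {suc k} c = cong (c +_) (sumF-const {k} c)

sumF-+ : ∀ {k} (f g : Fin k → ℕ) → sumF (λ i → f i + g i) ≡ sumF f + sumF g
sumF-+ f g = begin
  sumF (λ i → f i + g i) ≡⟨ sumF≡sum (λ i → f i + g i) ⟩
  sum (λ i → f i + g i)  ≡⟨ ∑-distrib-+ f g ⟩
  sum f + sum g          ≡⟨ sym (cong₂ _+_ (sumF≡sum f) (sumF≡sum g)) ⟩
  sumF f + sumF g        ∎
  where open ≡-Reasoning

sumF-* : ∀ {k} c (f : Fin k → ℕ) → sumF (λ i → c * f i) ≡ c * sumF f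
sumF-* c f = begin
  sumF (λ i → c * f i) ≡⟨ sumF≡sum (λ i → c * f i) ⟩
  sum (λ i → c * f i)  ≡⟨ *-distribˡ-sum c f ⟨
  c * sum f            ≡⟨ cong (c *_) (sumF≡sum f) ⟨
  c * sumF f           ∎
  where open ≡-Reasoning

sumF-comm : ∀ {a b} (h : Fin a → Fin b → ℕ) →
  sumF (λ i → sumF (h i)) ≡ sumF (λ j → sumF (λ i → h i j))
sumF-comm h = begin
  sumF (λ i → sumF (h i))         ≡⟨ sumF≡sum (λ i → sumF (h i)) ⟩
  sum (λ i → sumF (h i))          ≡⟨ sum-cong-≗ (λ i → sumF≡sum (h i)) ⟩
  sum (λ i → sum (h i))           ≡⟨ ∑-comm h ⟩
  sum (λ j → sum (λ i → h i j))   ≡⟨ sum-cong-≗ (λ j → sumF≡sum (λ i → h i j)) ⟨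
  sum (λ j → sumF (λ i → h i j))  ≡⟨ sumF≡sum (λ j → sumF (λ i → h i j)) ⟨
  sumF (λ j → sumF (λ i → h i j)) ∎
  where open ≡-Reasoning

indicator : Bool → ℕ
indicator b = if b then 1 else 0

count-sumF : ∀ {k} (f : Fin k → Bool) → count f ≡ sumF (λ i → indicator (f i))
count-sumF {zero}  f = refl
count-sumF {suc k} f = cong (indicator (f F.zero) +_) (count-sumF (λ i → f (F.suc i)))

count-cong : ∀ {k} {f g : Fin k → Bool} → (∀ i → f i ≡ g i) → count f ≡ count g
count-cong {zero}  f≗g = refl
count-cong {suc k} f≗g = cong₂ _+_ (cong indicator (f≗g F.zero)) (count-cong (λ i → f≗g (F.suc i)))

count-mono : ∀ {k} {f g : Fin k → Bool} → (∀ i → f i ≡ true → g i ≡ true) → count f ≤ count g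
count-mono {zero} f⇒g = z≤n
count-mono {suc k} {f} {g} f⇒g with f F.zero in f₀ | g F.zero in g₀
... | true  | true  = s≤s (count-mono (λ i → f⇒g (F.suc i)))
... | true  | false with () ← trans (sym (f⇒g F.zero f₀)) g₀
... | false | true  = m≤n⇒m≤1+n (count-mono (λ i → f⇒g (F.suc i)))
... | false | false = count-mono (λ i → f⇒g (F.suc i))

count-≡0 : ∀ {k} (f : Fin k → Bool) → (∀ i → f i ≡ false) → count f ≡ 0
count-≡0 {zero}  f none = refl
count-≡0 {suc k} f none rewrite none F.zero = count-≡0 (λ i → f (F.suc i)) (λ i → none (F.suc i))

count-witness : ∀ {k} (f : Fin k → Bool) → 1 ≤ count f → ∃ λ i → f i ≡ true
count-witness {suc k} f pos with f F.zero in f₀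
... | true  = F.zero , f₀
... | false with i , fi ← count-witness (λ i → f (F.suc i)) pos = F.suc i , fi

allF-true : ∀ {k} {f : Fin k → Bool} → (∀ i → f i ≡ true) → allF f ≡ true
allF-true {zero}  all = refl
allF-true {suc k} all rewrite all F.zero = allF-true (λ i → all (F.suc i))

allBelow-true : ∀ {N} {p : ℕ → Bool} → allBelow N p ≡ true → ∀ {k} → k < N → p k ≡ true
allBelow-true {suc N} {p} all {k} k<1+N with m<1+n⇒m<n∨m≡n k<1+N
... | inj₁ k<N  = allBelow-true (∧-conicalˡ _ _ all) k<N
... | inj₂ refl = ∧-conicalʳ (allBelow N p) _ all

<ᵇ-true : ∀ {a b} → a < b → (a <ᵇ b) ≡ true
<ᵇ-true a<b = Equivalence.to T-≡ (<⇒<ᵇ a<b)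

<ᵇ-false : ∀ {a b} → b ≤ a → (a <ᵇ b) ≡ false
<ᵇ-false {a} {b} b≤a with a <ᵇ b in e
... | false = refl
... | true  = ⊥-elim (<⇒≱ (<ᵇ⇒< a b (Equivalence.from T-≡ e)) b≤a)

eqF-refl : ∀ {k} (x : Fin k) → eqF x x ≡ true
eqF-refl x = Equivalence.to T-≡ (≡⇒≡ᵇ (toℕ x) (toℕ x) refl)

eqF⇒≡ : ∀ {k} {x y : Fin k} → eqF x y ≡ true → x ≡ y
eqF⇒≡ {x = x} {y} e = toℕ-injective (≡ᵇ⇒≡ (toℕ x) (toℕ y) (Equivalence.from T-≡ e))

not-eqF⇒≢ : ∀ {k} {x y : Fin k} → not (eqF x y) ≡ true → x ≢ y
not-eqF⇒≢ {x = x} ne refl with () ← subst (λ b → not b ≡ true) (eqF-refl x) ne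

count-remove : ∀ {k} (f : Fin k → Bool) (c : Fin k) → f c ≡ true →
  count f ≡ suc (count (λ j → f j ∧ not (eqF j c)))
count-remove {suc k} f F.zero fc rewrite fc =
  cong suc (count-cong (λ i → sym (∧-identityʳ (f (F.suc i)))))
count-remove {suc k} f (F.suc c) fc with f F.zero
... | true  = cong suc (count-remove (λ i → f (F.suc i)) c fc)
... | false = count-remove (λ i → f (F.suc i)) c fc

count-≤-injection : ∀ {a b} (P : Fin a → Bool) (Q : Fin b → Bool) (g : Fin a → Fin b) →
  (∀ i → P i ≡ true → Q (g i) ≡ true) →
  (∀ i j → P i ≡ true → P j ≡ true → g i ≡ g j → i ≡ j) →
  count P ≤ count Q
count-≤-injection {zero} P Q g P⇒Q g-inj = z≤n
count-≤-injection {suc a} P Q g P⇒Q g-inj with P F.zero in P₀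
... | false = count-≤-injection (λ i → P (F.suc i)) Q (λ i → g (F.suc i)) (λ i → P⇒Q (F.suc i))
                (λ i j pi pj eq → F-suc-injective (g-inj (F.suc i) (F.suc j) pi pj eq))
... | true = begin
  suc (count (λ i → P (F.suc i)))          ≤⟨ s≤s (count-≤-injection (λ i → P (F.suc i)) Q′ (λ i → g (F.suc i)) P⇒Q′ g-inj′) ⟩
  suc (count Q′)                           ≡⟨ count-remove Q (g F.zero) (P⇒Q F.zero P₀) ⟨
  count Q                                  ∎
  where
  open ≤-Reasoning
  Q′ : Fin _ → Bool
  Q′ j = Q j ∧ not (eqF j (g F.zero))
  g-inj′ : ∀ i j → P (F.suc i) ≡ true → P (F.suc j) ≡ true → g (F.suc i) ≡ g (F.suc j) → i ≡ j
  g-inj′ i j pi pj eq = F-suc-injective (g-inj (F.suc i) (F.suc j) pi pj eq)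
  P⇒Q′ : ∀ i → P (F.suc i) ≡ true → Q′ (g (F.suc i)) ≡ true
  P⇒Q′ i pi with eqF (g (F.suc i)) (g F.zero) in e
  ... | true with () ← g-inj (F.suc i) F.zero pi P₀ (eqF⇒≡ e)
  ... | false rewrite P⇒Q (F.suc i) pi = refl

count-↑ : ∀ {m n} (f : Fin (m + n) → Bool) →
  count f ≡ count (λ i → f (i ↑ˡ n)) + count (λ j → f (m ↑ʳ j))
count-↑ {zero}  f = refl
count-↑ {suc m} f = trans (cong (indicator (f F.zero) +_) (count-↑ {m} (λ i → f (F.suc i))))
                          (sym (+-assoc (indicator (f F.zero)) _ _))

count-combine : ∀ {m n} (f : Fin (m * n) → Bool) →
  count f ≡ sumF {m} (λ i → count {n} (λ j → f (combine i j)))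
count-combine {zero}      f = refl
count-combine {suc m} {n} f = trans (count-↑ {n} {m * n} f)
  (cong (count (λ j → f (j ↑ˡ (m * n))) +_) (count-combine {m} (λ c → f (n ↑ʳ c))))

count-remQuot : ∀ {m n} (P : Fin m → Fin n → Bool) →
  count (λ c → uncurry P (remQuot n c)) ≡ sumF (λ i → count (P i))
count-remQuot {m} {n} P = trans (count-combine {m} {n} _)
  (sumF-cong (λ i → count-cong (λ j → cong (uncurry P) (remQuot-combine i j))))

remQuot-injective : ∀ {m} n {c c′ : Fin (m * n)} → remQuot {m} n c ≡ remQuot n c′ → c ≡ c′
remQuot-injective {m} n {c} {c′} eq =
  trans (sym (combine-remQuot {m} n c)) (trans (cong (uncurry (combine {m} {n})) eq) (combine-remQuot {m} n c′))

module _ (G : Graph) where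

  Edge-sym : ∀ {x y} → Edge G x y → Edge G y x
  Edge-sym {x} {y} e = trans (adj-sym G y x) e

  Edge⇒≢ : ∀ {x y} → Edge G x y → x ≢ y
  Edge⇒≢ {x} e refl with () ← trans (sym e) (adj-irrefl G x)

  adj-split-by-order : ∀ x y → indicator (adj G x y) ≡
    indicator (adj G x y ∧ (toℕ x <ᵇ toℕ y)) + indicator (adj G x y ∧ (toℕ y <ᵇ toℕ x))
  adj-split-by-order x y with adj G x y in e | <-cmp (toℕ x) (toℕ y)
  ... | false | _ = refl
  ... | true | tri< x<y _ _ rewrite <ᵇ-true x<y | <ᵇ-false (<⇒≤ x<y) = refl
  ... | true | tri> _ _ y<x rewrite <ᵇ-true y<x | <ᵇ-false (<⇒≤ y<x) = refl
  ... | true | tri≈ _ x≡y _ with refl ← toℕ-injective x≡y = ⊥-elim (Edge⇒≢ e refl)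

  handshake : sumF (degree G) ≡ 2 * #edges G
  handshake = begin
    sumF (λ x → count (adj G x))                   ≡⟨ sumF-cong (λ x → count-sumF (adj G x)) ⟩
    sumF (λ x → sumF (λ y → indicator (adj G x y))) ≡⟨ sumF-cong (λ x → sumF-cong (adj-split-by-order x)) ⟩
    sumF (λ x → sumF (λ y → up x y + down x y))    ≡⟨ sumF-cong (λ x → sumF-+ (up x) (down x)) ⟩
    sumF (λ x → sumF (up x) + sumF (down x))       ≡⟨ sumF-+ (λ x → sumF (up x)) (λ x → sumF (down x)) ⟩
    E + sumF (λ x → sumF (down x))                 ≡⟨ cong (E +_) (sumF-comm down) ⟩
    E + sumF (λ y → sumF (λ x → down x y))         ≡⟨ cong (E +_) (sumF-cong (λ y → sumF-cong (λ x → down≡up x y))) ⟩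
    E + E                                          ≡⟨ cong (E +_) (+-identityʳ E) ⟨
    2 * E                                          ≡⟨ cong (2 *_) (sumF-cong (λ x → count-sumF (λ y → adj G x y ∧ (toℕ x <ᵇ toℕ y)))) ⟨
    2 * #edges G                                   ∎
    where
    open ≡-Reasoning
    up down : Vertex G → Vertex G → ℕ
    up   x y = indicator (adj G x y ∧ (toℕ x <ᵇ toℕ y))
    down x y = indicator (adj G x y ∧ (toℕ y <ᵇ toℕ x))
    down≡up : ∀ x y → down x y ≡ up y x
    down≡up x y = cong (λ b → indicator (b ∧ (toℕ y <ᵇ toℕ x))) (adj-sym G x y)
    E : ℕ
    E = sumF (λ x → sumF (up x))

  #components-pos : 1 ≤ n G → 1 ≤ #components G
  #components-pos 1≤n = subst (1 ≤_) (sym (count-remove _ v v-least)) (s≤s z≤n)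
    where
    v : Vertex G
    v = F.fromℕ< 1≤n
    v-least : allF (λ u → not (reachable G v u) ∨ (toℕ v ≤ᵇ toℕ u)) ≡ true
    v-least = allF-true (λ u → trans (cong (λ t → not (reachable G v u) ∨ (t ≤ᵇ toℕ u)) (toℕ-fromℕ< 1≤n)) (∨-zeroʳ _))

  #isolated≡0 : (∀ x → 2 ≤ degree G x) → #isolated G ≡ 0
  #isolated≡0 δ≥2 = count-≡0 _ (λ x → not-isolated (degree G x) (δ≥2 x))
    where
    not-isolated : ∀ d → 2 ≤ d → (d ≡ᵇ 0) ≡ false
    not-isolated (suc d) _ = refl

module Faces (G : Graph) (ρ : RotationSystem G) where
  open RotationSystem ρ

  φ : Vertex G × Vertex G → Vertex G × Vertex G
  φ = faceStep ρ

  Dart : Vertex G × Vertex G → Set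
  Dart (x , y) = Edge G x y

  φ-dart : ∀ {d} → Dart d → Dart (φ d)
  φ-dart {x , y} e = rot-adj y x (Edge-sym G e)

  iter-dart : ∀ k {d} → Dart d → Dart (iter φ k d)
  iter-dart zero    e = e
  iter-dart (suc k) e = φ-dart (iter-dart k e)

  iter-+ : ∀ k m d → iter φ (k + m) d ≡ iter φ k (iter φ m d)
  iter-+ zero    m d = refl
  iter-+ (suc k) m d = cong φ (iter-+ k m d)

  φ-injective : ∀ {d d′} → Dart d → Dart d′ → φ d ≡ φ d′ → d ≡ d′
  φ-injective {x , y} {x′ , y′} e e′ eq with refl ← cong proj₁ eq =
    cong (_, y) (rot-inj y x x′ (Edge-sym G e) (Edge-sym G e′) (cong proj₂ eq))

  iter-injective : ∀ k {d d′} → Dart d → Dart d′ → iter φ k d ≡ iter φ k d′ → d ≡ d′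
  iter-injective zero    e e′ eq = eq
  iter-injective (suc k) e e′ eq = iter-injective k e e′ (φ-injective (iter-dart k e) (iter-dart k e′) eq)

  #pairs : ℕ
  #pairs = n G * n G

  dartIndex : Vertex G × Vertex G → Fin #pairs
  dartIndex = uncurry combine

  dartIndex-injective : ∀ {d d′} → dartIndex d ≡ dartIndex d′ → d ≡ d′
  dartIndex-injective {x , y} {x′ , y′} eq with refl , refl ← combine-injective x y x′ y′ eq = refl

  dartCode≡toℕ-dartIndex : ∀ d → dartCode ρ d ≡ toℕ (dartIndex d)
  dartCode≡toℕ-dartIndex (x , y) = trans (cong (_+ toℕ y) (*-comm (toℕ x) (n G))) (sym (toℕ-combine x y))

  dartCode-injective : ∀ {d d′} → dartCode ρ d ≡ dartCode ρ d′ → d ≡ d′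
  dartCode-injective {d} {d′} eq = dartIndex-injective (toℕ-injective
    (trans (sym (dartCode≡toℕ-dartIndex d)) (trans eq (dartCode≡toℕ-dartIndex d′))))

  φ-period : ∀ {d} → Dart d → ∃ λ p → 1 ≤ p × p ≤ #pairs × iter φ p d ≡ d
  φ-period {d} e with i , j , i<j , eq ← pigeonhole (n<1+n #pairs) (λ k → dartIndex (iter φ (toℕ k) d)) =
    toℕ j ∸ toℕ i , m<n⇒0<n∸m i<j , ≤-trans (m∸n≤m (toℕ j) (toℕ i)) (≤-pred (toℕ<n j)) , sym d≡φᵖd
    where
    φⁱd≡φⁱφᵖd : iter φ (toℕ i) d ≡ iter φ (toℕ i) (iter φ (toℕ j ∸ toℕ i) d)
    φⁱd≡φⁱφᵖd = trans (dartIndex-injective eq)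
      (trans (cong (λ t → iter φ t d) (sym (m+[n∸m]≡n (<⇒≤ i<j)))) (iter-+ (toℕ i) (toℕ j ∸ toℕ i) d))
    d≡φᵖd : d ≡ iter φ (toℕ j ∸ toℕ i) d
    d≡φᵖd = iter-injective (toℕ i) e (iter-dart (toℕ j ∸ toℕ i) e) φⁱd≡φⁱφᵖd

  dartAt : Fin #pairs → Vertex G × Vertex G
  dartAt = remQuot (n G)

  dartAt-dartIndex : ∀ d → dartAt (dartIndex d) ≡ d
  dartAt-dartIndex (x , y) = remQuot-combine x y

  FaceRep : Vertex G × Vertex G → Set
  FaceRep d = isFaceRep ρ d ≡ true

  FaceRep⇒Dart : ∀ {r} → FaceRep r → Dart r
  FaceRep⇒Dart rep = ∧-conicalˡ _ _ rep

  FaceRep-minimal : ∀ {r} → FaceRep r → ∀ {k} → k < #pairs → dartCode ρ r ≤ dartCode ρ (iter φ k r)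
  FaceRep-minimal {r} rep k<N = ≤ᵇ⇒≤ _ _ (Equivalence.from T-≡ (allBelow-true (∧-conicalʳ (adj G (proj₁ r) (proj₂ r)) _ rep) k<N))

  module _ (δ≥2 : ∀ x → 2 ≤ degree G x) where

    rot-no-fixpoint : ∀ {y x} → Edge G y x → rot y x ≢ x
    rot-no-fixpoint {y} {x} e fixed with count-witness (λ j → adj G y j ∧ not (eqF j x))
                                           (≤-pred (subst (2 ≤_) (count-remove (adj G y) x e) (δ≥2 y)))
    ... | z , z-other with k , rotᵏx≡z ← rot-cyc y x z e (∧-conicalˡ _ _ z-other) =
      not-eqF⇒≢ (∧-conicalʳ (adj G y z) _ z-other) (trans (sym rotᵏx≡z) (iterate-fixed k))
      where
      iterate-fixed : ∀ k → iter (rot y) k x ≡ x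
      iterate-fixed zero    = refl
      iterate-fixed (suc k) = trans (cong (rot y) (iterate-fixed k)) fixed

    faceWalk : Vertex G × Vertex G → ℕ → Vertex G
    faceWalk d k = proj₁ (iter φ k d)

    faceWalk-edge : ∀ {d} → Dart d → ∀ k → Edge G (faceWalk d k) (faceWalk d (suc k))
    faceWalk-edge e k = iter-dart k e

    faceWalk-no-backtrack : ∀ {d} → Dart d → ∀ k → faceWalk d (2 + k) ≢ faceWalk d k
    faceWalk-no-backtrack e k = rot-no-fixpoint (Edge-sym G (iter-dart k e))

    faceWalk-periodic : ∀ {d p} → iter φ p d ≡ d → ∀ k → faceWalk d (k + p) ≡ faceWalk d k
    faceWalk-periodic {d} {p} φᵖd≡d k = cong proj₁ (trans (iter-+ k p d) (cong (iter φ k) φᵖd≡d))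

    -- For a closed walk of length at most 4, two distinct positions are at
    -- cyclic distance 1 or 2.
    faceWalk-distinct : ∀ {d p} → Dart d → p ≤ 4 → iter φ p d ≡ d →
                        ∀ {i j} → i < j → j < p → faceWalk d i ≢ faceWalk d j
    faceWalk-distinct {d} {p} e p≤4 φᵖd≡d i<j j<p = distinct i<j (≤-trans j<p p≤4) j<p
      where
      distinct : ∀ {i j} → i < j → j < 4 → j < p → faceWalk d i ≢ faceWalk d j
      distinct {0} {1} _ _ _ = Edge⇒≢ G (faceWalk-edge e 0)
      distinct {1} {2} _ _ _ = Edge⇒≢ G (faceWalk-edge e 1)
      distinct {2} {3} _ _ _ = Edge⇒≢ G (faceWalk-edge e 2)
      distinct {0} {2} _ _ _ = faceWalk-no-backtrack e 0 ∘ sym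
      distinct {1} {3} _ _ _ = faceWalk-no-backtrack e 1 ∘ sym
      distinct {0} {3} _ _ 3<p with refl ← ≤-antisym p≤4 3<p =
        λ eq → Edge⇒≢ G (faceWalk-edge e 3) (trans (sym eq) (sym (faceWalk-periodic {p = 4} φᵖd≡d 0)))
      distinct {j = 0} () _ _
      distinct {suc _} {1} (s≤s ()) _ _
      distinct {suc (suc _)} {2} (s≤s (s≤s ())) _ _
      distinct {suc (suc (suc _))} {3} (s≤s (s≤s (s≤s ()))) _ _
      distinct {j = suc (suc (suc (suc _)))} _ (s≤s (s≤s (s≤s (s≤s ())))) _

    face-cycle : ∀ {d p} → Dart d → 3 ≤ p → p ≤ 4 → iter φ p d ≡ d → IsCycle G p (λ i → faceWalk d (toℕ i))
    face-cycle {d} {p} e 3≤p p≤4 φᵖd≡d = record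
      { length≥3  = 3≤p
      ; injective = injective
      ; step      = λ i j eq → subst (λ k → Edge G (faceWalk d (toℕ i)) (faceWalk d k)) eq (faceWalk-edge e (toℕ i))
      ; close     = close
      }
      where
      injective : ∀ {i j} → faceWalk d (toℕ i) ≡ faceWalk d (toℕ j) → i ≡ j
      injective {i} {j} eq with <-cmp (toℕ i) (toℕ j)
      ... | tri< i<j _ _ = ⊥-elim (faceWalk-distinct e p≤4 φᵖd≡d i<j (toℕ<n j) eq)
      ... | tri≈ _ i≡j _ = toℕ-injective i≡j
      ... | tri> _ _ j<i = ⊥-elim (faceWalk-distinct e p≤4 φᵖd≡d j<i (toℕ<n i) (sym eq))
      close : ∀ i j → suc (toℕ i) ≡ p → toℕ j ≡ 0 → Edge G (faceWalk d (toℕ i)) (faceWalk d (toℕ j))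
      close i j last first = subst (Edge G (faceWalk d (toℕ i))) wraps (faceWalk-edge e (toℕ i))
        where
        wraps : faceWalk d (suc (toℕ i)) ≡ faceWalk d (toℕ j)
        wraps = trans (cong (faceWalk d) last)
                      (trans (faceWalk-periodic {p = p} φᵖd≡d 0) (cong (faceWalk d) (sym first)))

    module _ (girth≥5 : GirthAtLeast5 G) where

      no-short-face : ∀ {d p} → Dart d → 1 ≤ p → p ≤ 4 → iter φ p d ≢ d
      no-short-face {p = 1} e _ _ φd≡d = Edge⇒≢ G (faceWalk-edge e 0) (sym (cong proj₁ φd≡d))
      no-short-face {p = 2} e _ _ φ²d≡d = faceWalk-no-backtrack e 0 (cong proj₁ φ²d≡d)
      no-short-face {p = p@(suc (suc (suc _)))} e _ p≤4 φᵖd≡d =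
        1+n≰n (≤-trans (girth≥5 p _ (face-cycle e (s≤s (s≤s (s≤s z≤n))) p≤4 φᵖd≡d)) p≤4)

      face-length≥5 : ∀ {d p} → Dart d → 1 ≤ p → iter φ p d ≡ d → 5 ≤ p
      face-length≥5 {p = p} e 1≤p φᵖd≡d with p ≤? 4
      ... | yes p≤4 = ⊥-elim (no-short-face e 1≤p p≤4 φᵖd≡d)
      ... | no  p≰4 = ≰⇒> p≰4

      FaceRep-unique : ∀ {r r′ m} → FaceRep r → FaceRep r′ → 1 ≤ m → m ≤ 4 → r ≡ iter φ m r′ → r ≡ r′
      FaceRep-unique {r} {r′} {m} rep rep′ 1≤m m≤4 r≡φᵐr′
        with p , 1≤p , p≤N , φᵖr′≡r′ ← φ-period (FaceRep⇒Dart rep′) =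
        dartCode-injective (≤-antisym r≤r′ r′≤r)
        where
        m<p : m < p
        m<p = ≤-trans (s≤s m≤4) (face-length≥5 (FaceRep⇒Dart rep′) 1≤p φᵖr′≡r′)
        r′≤r : dartCode ρ r′ ≤ dartCode ρ r
        r′≤r = subst (λ t → dartCode ρ r′ ≤ dartCode ρ t) (sym r≡φᵐr′) (FaceRep-minimal rep′ (≤-trans m<p p≤N))
        φᵖ⁻ᵐr≡r′ : iter φ (p ∸ m) r ≡ r′
        φᵖ⁻ᵐr≡r′ = begin
          iter φ (p ∸ m) r              ≡⟨ cong (iter φ (p ∸ m)) r≡φᵐr′ ⟩
          iter φ (p ∸ m) (iter φ m r′)  ≡⟨ iter-+ (p ∸ m) m r′ ⟨
          iter φ (p ∸ m + m) r′         ≡⟨ cong (λ t → iter φ t r′) (m∸n+n≡m (<⇒≤ m<p)) ⟩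
          iter φ p r′                   ≡⟨ φᵖr′≡r′ ⟩
          r′                            ∎
          where open ≡-Reasoning
        r≤r′ : dartCode ρ r ≤ dartCode ρ r′
        r≤r′ = subst (λ t → dartCode ρ r ≤ dartCode ρ t) φᵖ⁻ᵐr≡r′
                 (FaceRep-minimal rep (≤-trans (∸-monoʳ-< {p} {m} {0} 1≤m (<⇒≤ m<p)) p≤N))

      face-darts-distinct : ∀ {i j r r′} → i < j → j ≤ 4 → FaceRep r → FaceRep r′ → iter φ i r ≢ iter φ j r′
      face-darts-distinct {i} {j} {r} {r′} i<j j≤4 rep rep′ eq =
        no-short-face (FaceRep⇒Dart rep) 1≤m m≤4 (sym (subst (λ t → r ≡ iter φ m t) (sym r≡r′) r≡φᵐr′))
        where
        m = j ∸ i
        1≤m : 1 ≤ m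
        1≤m = m<n⇒0<n∸m i<j
        m≤4 : m ≤ 4
        m≤4 = ≤-trans (m∸n≤m j i) j≤4
        r≡φᵐr′ : r ≡ iter φ m r′
        r≡φᵐr′ = iter-injective i (FaceRep⇒Dart rep) (iter-dart m (FaceRep⇒Dart rep′))
          (trans eq (trans (cong (λ t → iter φ t r′) (sym (m+[n∸m]≡n (<⇒≤ i<j)))) (iter-+ i m r′)))
        r≡r′ : r ≡ r′
        r≡r′ = FaceRep-unique rep rep′ 1≤m m≤4 r≡φᵐr′

      face-darts-injective : ∀ {i j r r′} → i ≤ 4 → j ≤ 4 → FaceRep r → FaceRep r′ →
                             iter φ i r ≡ iter φ j r′ → i ≡ j × r ≡ r′
      face-darts-injective {i} {j} i≤4 j≤4 rep rep′ eq with <-cmp i j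
      ... | tri< i<j _ _ = ⊥-elim (face-darts-distinct i<j j≤4 rep rep′ eq)
      ... | tri≈ _ refl _ = refl , iter-injective i (FaceRep⇒Dart rep) (FaceRep⇒Dart rep′) eq
      ... | tri> _ _ j<i = ⊥-elim (face-darts-distinct j<i i≤4 rep′ rep (sym eq))

      -- The first five darts of the faces are pairwise distinct.
      faces-sparse : 5 * #faces ρ ≤ 2 * #edges G
      faces-sparse = begin
        5 * #faces ρ                                   ≡⟨ cong (5 *_) (count-remQuot (λ x y → isFaceRep ρ (x , y))) ⟨
        5 * count (λ c → isFaceRep ρ (dartAt c))       ≡⟨ sumF-const {5} (count (λ c → isFaceRep ρ (dartAt c))) ⟨
        sumF {5} (λ _ → count (λ c → isFaceRep ρ (dartAt c)))
                                                       ≡⟨ count-remQuot {5} {#pairs} (λ _ c → isFaceRep ρ (dartAt c)) ⟨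
        count (λ c → isFaceRep ρ (dartAt (proj₂ (remQuot {5} #pairs c))))
                                                       ≤⟨ count-≤-injection _ _ walkDart walkDart-dart walkDart-injective ⟩
        count (λ c → uncurry (adj G) (dartAt c))       ≡⟨ count-remQuot (adj G) ⟩
        sumF (degree G)                                ≡⟨ handshake G ⟩
        2 * #edges G                                   ∎
        where
        open ≤-Reasoning
        faceDart : Fin 5 × Fin #pairs → Vertex G × Vertex G
        faceDart (i , c) = iter φ (toℕ i) (dartAt c)
        walkDart : Fin (5 * #pairs) → Fin #pairs
        walkDart c = dartIndex (faceDart (remQuot #pairs c))
        walkDart-dart : ∀ c → isFaceRep ρ (dartAt (proj₂ (remQuot #pairs c))) ≡ true →
                        uncurry (adj G) (dartAt (walkDart c)) ≡ true
        walkDart-dart c rep = subst (λ d → uncurry (adj G) d ≡ true) (sym (dartAt-dartIndex _))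
                                    (iter-dart (toℕ (proj₁ (remQuot #pairs c))) (FaceRep⇒Dart rep))
        walkDart-injective : ∀ c c′ → isFaceRep ρ (dartAt (proj₂ (remQuot #pairs c))) ≡ true →
                             isFaceRep ρ (dartAt (proj₂ (remQuot #pairs c′))) ≡ true →
                             walkDart c ≡ walkDart c′ → c ≡ c′
        walkDart-injective c c′ rep rep′ eq
          with i≡i′ , d≡d′ ← face-darts-injective (≤-pred (toℕ<n (proj₁ (remQuot {5} #pairs c))))
                                                  (≤-pred (toℕ<n (proj₁ (remQuot {5} #pairs c′))))
                                                  rep rep′ (dartIndex-injective eq) =
          remQuot-injective #pairs (cong₂ _,_ (toℕ-injective i≡i′) (remQuot-injective (n G) d≡d′))

fromLarge : ℕ → ℕ
fromLarge 2 = 12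
fromLarge 3 = 3
fromLarge _ = 0

fromMedium : ℕ → ℕ
fromMedium 3 = 2
fromMedium _ = 0

-- Charges are scaled by 6, so the transfers 2, 1/2 and 1/3 become 12, 3 and 2.
transfer : ℕ → ℕ → ℕ
transfer (suc (suc (suc (suc (suc (suc (suc _))))))) b = fromLarge b
transfer 5 b = fromMedium b
transfer 6 b = fromMedium b
transfer _ _ = 0

fromMedium≤2 : ∀ b → fromMedium b ≤ 2
fromMedium≤2 0 = z≤n
fromMedium≤2 1 = z≤n
fromMedium≤2 2 = z≤n
fromMedium≤2 3 = ≤-refl
fromMedium≤2 (suc (suc (suc (suc _)))) = z≤n

fromLarge≤ : ∀ b → fromLarge b ≤ 3 + 9 * indicator (b ≡ᵇ 2)
fromLarge≤ 0 = z≤n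
fromLarge≤ 1 = z≤n
fromLarge≤ 2 = ≤-refl
fromLarge≤ 3 = ≤-refl
fromLarge≤ (suc (suc (suc (suc _)))) = z≤n

transfer≤ : ∀ a b → transfer a b ≤ 3 + 9 * indicator (b ≡ᵇ 2)
transfer≤ 0 b = z≤n
transfer≤ 1 b = z≤n
transfer≤ 2 b = z≤n
transfer≤ 3 b = z≤n
transfer≤ 4 b = z≤n
transfer≤ 5 b = ≤-trans (fromMedium≤2 b) (s≤s (s≤s z≤n))
transfer≤ 6 b = ≤-trans (fromMedium≤2 b) (s≤s (s≤s z≤n))
transfer≤ (suc (suc (suc (suc (suc (suc (suc _))))))) b = fromLarge≤ b

transfer-large : ∀ {a} → 7 ≤ a → ∀ b → transfer a b ≡ fromLarge b
transfer-large (s≤s (s≤s (s≤s (s≤s (s≤s (s≤s (s≤s _))))))) b = refl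

transfer-to-3 : ∀ {a} → 5 ≤ a → 2 ≤ transfer a 3
transfer-to-3 {1} (s≤s ())
transfer-to-3 {2} (s≤s (s≤s ()))
transfer-to-3 {3} (s≤s (s≤s (s≤s ())))
transfer-to-3 {4} (s≤s (s≤s (s≤s (s≤s ()))))
transfer-to-3 {5} _ = ≤-refl
transfer-to-3 {6} _ = ≤-refl
transfer-to-3 {suc (suc (suc (suc (suc (suc (suc _))))))} _ = s≤s (s≤s z≤n)

budget-7-9 : ∀ k t → t + 2 ≤ 7 + k → 60 + (3 * (7 + k) + 9 * t) ≤ 18 * (7 + k)
budget-7-9 k t t+2≤d = begin
  60 + (3 * (7 + k) + 9 * t)        ≤⟨ +-monoʳ-≤ 60 (+-monoʳ-≤ (3 * (7 + k)) (*-monoʳ-≤ 9 t≤5+k)) ⟩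
  60 + (3 * (7 + k) + 9 * (5 + k))  ≡⟨ expand k ⟩
  126 + 12 * k                      ≤⟨ +-monoʳ-≤ 126 (*-monoˡ-≤ k (m≤m+n 12 6)) ⟩
  126 + 18 * k                      ≡⟨ *-distribˡ-+ 18 7 k ⟨
  18 * (7 + k)                      ∎
  where
  open ≤-Reasoning
  t≤5+k : t ≤ 5 + k
  t≤5+k = +-cancelʳ-≤ 2 t (5 + k) (subst (t + 2 ≤_) (+-comm 2 (5 + k)) t+2≤d)
  expand : ∀ k → 60 + (3 * (7 + k) + 9 * (5 + k)) ≡ 126 + 12 * k
  expand = solve-∀

budget-10 : ∀ k t → t ≤ 10 + k → 60 + (3 * (10 + k) + 9 * t) ≤ 18 * (10 + k)
budget-10 k t t≤d = begin
  60 + (3 * (10 + k) + 9 * t)         ≤⟨ +-monoʳ-≤ 60 (+-monoʳ-≤ (3 * (10 + k)) (*-monoʳ-≤ 9 t≤d)) ⟩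
  60 + (3 * (10 + k) + 9 * (10 + k))  ≡⟨ expand k ⟩
  180 + 12 * k                        ≤⟨ +-monoʳ-≤ 180 (*-monoˡ-≤ k (m≤m+n 12 6)) ⟩
  180 + 18 * k                        ≡⟨ *-distribˡ-+ 18 10 k ⟨
  18 * (10 + k)                       ∎
  where
  open ≤-Reasoning
  expand : ∀ k → 60 + (3 * (10 + k) + 9 * (10 + k)) ≡ 180 + 12 * k
  expand = solve-∀

Configuration : Graph → Set
Configuration G = C1-1 G ⊎ C1-2 G ⊎ C1-3 G ⊎ C1-4 G

module Discharging (G : Graph) where

  sumNbr : Vertex G → (Vertex G → ℕ) → ℕ
  sumNbr x h = sumF (λ y → if adj G x y then h y else 0)

  sumNbr-comm : ∀ (h : Vertex G → Vertex G → ℕ) →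
    sumF (λ x → sumNbr x (h x)) ≡ sumF (λ x → sumNbr x (λ y → h y x))
  sumNbr-comm h = trans (sumF-comm (λ x y → if adj G x y then h x y else 0))
    (sumF-cong (λ y → sumF-cong (λ x → cong (λ b → if b then h x y else 0) (adj-sym G x y))))

  sumNbr-≤ : ∀ x {h} c → (∀ y → Edge G x y → h y ≤ c) → sumNbr x h ≤ c * degree G x
  sumNbr-≤ x {h} c bounded = begin
    sumNbr x h                               ≤⟨ sumF-mono termwise ⟩
    sumF (λ y → c * indicator (adj G x y))   ≡⟨ sumF-* c (λ y → indicator (adj G x y)) ⟩
    c * sumF (λ y → indicator (adj G x y))   ≡⟨ cong (c *_) (count-sumF (adj G x)) ⟨
    c * degree G x                           ∎
    where
    open ≤-Reasoning
    termwise : ∀ y → (if adj G x y then h y else 0) ≤ c * indicator (adj G x y)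
    termwise y with adj G x y in e
    ... | true  = ≤-trans (bounded y e) (≤-reflexive (sym (*-identityʳ c)))
    ... | false = z≤n

  sumNbr-≥ : ∀ x {h} c (P : Vertex G → Bool) → (∀ y → P y ≡ true → Edge G x y) →
             (∀ y → P y ≡ true → c ≤ h y) → c * count P ≤ sumNbr x h
  sumNbr-≥ x {h} c P P⇒Edge bounded = begin
    c * count P                        ≡⟨ cong (c *_) (count-sumF P) ⟩
    c * sumF (λ y → indicator (P y))   ≡⟨ sumF-* c (λ y → indicator (P y)) ⟨
    sumF (λ y → c * indicator (P y))   ≤⟨ sumF-mono termwise ⟩
    sumNbr x h                         ∎
    where
    open ≤-Reasoning
    termwise : ∀ y → c * indicator (P y) ≤ (if adj G x y then h y else 0)
    termwise y with P y in e
    ... | false = ≤-trans (≤-reflexive (*-zeroʳ c)) z≤n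
    ... | true rewrite P⇒Edge y e = ≤-trans (≤-reflexive (*-identityʳ c)) (bounded y e)

  sentBy receivedBy : Vertex G → ℕ → ℕ
  sentBy     x d = sumNbr x (λ y → transfer d (degree G y))
  receivedBy x d = sumNbr x (λ y → transfer (degree G y) d)

  -- The final charge 18d - 60 - sent + received is nonnegative, with the
  -- subtractions moved across.
  Balanced : Vertex G → ℕ → Set
  Balanced x d = 60 + sentBy x d ≤ 18 * d + receivedBy x d

  sentBy-≤ : ∀ x d → sentBy x d ≤ 3 * degree G x + 9 * #deg2Neighbours G x
  sentBy-≤ x d = begin
    sentBy x d
      ≤⟨ sumF-mono termwise ⟩
    sumF (λ y → 3 * indicator (adj G x y) + 9 * indicator (deg2 y))
      ≡⟨ sumF-+ (λ y → 3 * indicator (adj G x y)) (λ y → 9 * indicator (deg2 y)) ⟩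
    sumF (λ y → 3 * indicator (adj G x y)) + sumF (λ y → 9 * indicator (deg2 y))
      ≡⟨ cong₂ _+_ (sumF-* 3 (λ y → indicator (adj G x y))) (sumF-* 9 (λ y → indicator (deg2 y))) ⟩
    3 * sumF (λ y → indicator (adj G x y)) + 9 * sumF (λ y → indicator (deg2 y))
      ≡⟨ cong₂ (λ a b → 3 * a + 9 * b) (count-sumF (adj G x)) (count-sumF deg2) ⟨
    3 * degree G x + 9 * #deg2Neighbours G x
      ∎
    where
    open ≤-Reasoning
    deg2 : Vertex G → Bool
    deg2 y = adj G x y ∧ (degree G y ≡ᵇ 2)
    termwise : ∀ y → (if adj G x y then transfer d (degree G y) else 0) ≤
                     3 * indicator (adj G x y) + 9 * indicator (deg2 y)
    termwise y with adj G x y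
    ... | true  = transfer≤ d (degree G y)
    ... | false = z≤n

  balanced-by-sending≤ : ∀ x d s → sentBy x d ≤ s → 60 + s ≤ 18 * d → Balanced x d
  balanced-by-sending≤ x d s sent≤s budget =
    ≤-trans (+-monoʳ-≤ 60 sent≤s) (≤-trans budget (m≤m+n (18 * d) (receivedBy x d)))

  balanced-by-receiving : ∀ x d → (∀ b → transfer d b ≡ 0) → 60 ≤ 18 * d + receivedBy x d → Balanced x d
  balanced-by-receiving x d sends-nothing =
    ≤-trans (+-monoʳ-≤ 60 (sumNbr-≤ x 0 (λ y _ → ≤-reflexive (sends-nothing (degree G y)))))

  balanced-2 : ∀ x → degree G x ≡ 2 → (∀ y → Edge G x y → 7 ≤ degree G y) → Balanced x 2
  balanced-2 x deg≡2 large = balanced-by-receiving x 2 (λ _ → refl) (+-monoʳ-≤ 36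
    (subst (λ t → 12 * t ≤ receivedBy x 2) deg≡2
      (sumNbr-≥ x 12 (adj G x) (λ _ e → e) (λ y e → ≤-reflexive (sym (transfer-large (large y e) 2))))))

  balanced-3 : ∀ x → degree G x ≡ 3 → (∀ y → Edge G x y → 5 ≤ degree G y) → Balanced x 3
  balanced-3 x deg≡3 medium = balanced-by-receiving x 3 (λ _ → refl) (+-monoʳ-≤ 54
    (subst (λ t → 2 * t ≤ receivedBy x 3) deg≡3
      (sumNbr-≥ x 2 (adj G x) (λ _ e → e) (λ y e → transfer-to-3 (medium y e)))))

  balanced-3-beside : ∀ x y₀ → degree G x ≡ 3 → Edge G x y₀ →
    (∀ z → (adj G x z ∧ not (eqF z y₀)) ≡ true → 7 ≤ degree G z) → Balanced x 3
  balanced-3-beside x y₀ deg≡3 e₀ large = balanced-by-receiving x 3 (λ _ → refl) (+-monoʳ-≤ 54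
    (subst (λ t → 3 * t ≤ receivedBy x 3) two-others
      (sumNbr-≥ x 3 _ (λ _ other → ∧-conicalˡ _ _ other) (λ z other → ≤-reflexive (sym (transfer-large (large z other) 3))))))
    where
    two-others : count (λ z → adj G x z ∧ not (eqF z y₀)) ≡ 2
    two-others = suc-injective (trans (sym (count-remove (adj G x) y₀ e₀)) deg≡3)

  balanced-4 : ∀ x → Balanced x 4
  balanced-4 x = balanced-by-receiving x 4 (λ _ → refl) (≤-trans (m≤m+n 60 12) (m≤m+n 72 (receivedBy x 4)))

  balanced-medium : ∀ x d → degree G x ≡ d → (∀ b → transfer d b ≤ 2) → 60 + 2 * d ≤ 18 * d → Balanced x d
  balanced-medium x d deg≡d ≤2 = balanced-by-sending≤ x d (2 * d)
    (subst (λ t → sentBy x d ≤ 2 * t) deg≡d (sumNbr-≤ x 2 (λ y _ → ≤2 (degree G y))))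

  balanced-large : ∀ x d → degree G x ≡ d → 60 + (3 * d + 9 * #deg2Neighbours G x) ≤ 18 * d → Balanced x d
  balanced-large x d deg≡d = balanced-by-sending≤ x d _
    (subst (λ t → sentBy x d ≤ 3 * t + 9 * #deg2Neighbours G x) deg≡d (sentBy-≤ x d))

  large-or-escape : ∀ {A : Set} (N : Vertex G → Bool) k →
    (∀ y → N y ≡ true → degree G y ≤ k → A) → A ⊎ (∀ y → N y ≡ true → suc k ≤ degree G y)
  large-or-escape {A} N k escape = ∀⊎ decide
    where
    decide : ∀ y → A ⊎ (N y ≡ true → suc k ≤ degree G y)
    decide y with N y in e | degree G y ≤? k
    ... | false | _      = inj₂ (λ ())
    ... | true  | yes ≤k = inj₁ (escape y e ≤k)
    ... | true  | no  ≰k = inj₂ (λ _ → ≰⇒> ≰k)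

  balanced-3-or-configuration : ∀ x → degree G x ≡ 3 → Configuration G ⊎ Balanced x 3
  balanced-3-or-configuration x deg≡3 with large-or-escape (adj G x) 4 (λ y e ≤4 → y , e , ≤4)
  ... | inj₂ medium = inj₂ (balanced-3 x deg≡3 medium)
  ... | inj₁ (y₀ , e₀ , ≤4) with large-or-escape (λ z → adj G x z ∧ not (eqF z y₀)) 6 C1-3-at
    where
    C1-3-at : ∀ z → (adj G x z ∧ not (eqF z y₀)) ≡ true → degree G z ≤ 6 → Configuration G
    C1-3-at z other ≤6 = inj₂ (inj₂ (inj₁
      (x , y₀ , z , deg≡3 , e₀ , ≤4 , ∧-conicalˡ _ _ other , not-eqF⇒≢ (∧-conicalʳ (adj G x z) _ other) , ≤6)))
  ... | inj₁ c     = inj₁ c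
  ... | inj₂ large = inj₂ (balanced-3-beside x y₀ deg≡3 e₀ large)

  balanced-7-9-or-C1-4 : ∀ x k → degree G x ≡ 7 + k → k ≤ 2 → Configuration G ⊎ Balanced x (7 + k)
  balanced-7-9-or-C1-4 x k deg≡d k≤2 with 6 + k ≤? #deg2Neighbours G x
  ... | yes many = inj₁ (inj₂ (inj₂ (inj₂ (x , 7 + k , m≤m+n 7 k , +-monoʳ-≤ 7 k≤2 , deg≡d , many))))
  ... | no  few  = inj₂ (balanced-large x (7 + k) deg≡d
                     (budget-7-9 k _ (subst (_≤ 7 + k) (+-comm 2 _) (s≤s (≰⇒> few)))))

  #deg2Neighbours≤degree : ∀ x → #deg2Neighbours G x ≤ degree G x
  #deg2Neighbours≤degree x = count-mono {f = λ y → adj G x y ∧ (degree G y ≡ᵇ 2)} (λ y deg2 → ∧-conicalˡ _ _ deg2)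

  module _ (δ≥2 : ∀ x → 2 ≤ degree G x) where

    balanced-or-configuration : ∀ x d → degree G x ≡ d → Configuration G ⊎ Balanced x d
    balanced-or-configuration x 0 deg≡0 with () ← subst (2 ≤_) deg≡0 (δ≥2 x)
    balanced-or-configuration x 1 deg≡1 with s≤s () ← subst (2 ≤_) deg≡1 (δ≥2 x)
    balanced-or-configuration x 2 deg≡2
      with large-or-escape (adj G x) 6 (λ y e ≤6 → inj₂ (inj₁ (x , y , deg≡2 , e , ≤6)))
    ... | inj₁ c     = inj₁ c
    ... | inj₂ large = inj₂ (balanced-2 x deg≡2 large)
    balanced-or-configuration x 3 deg≡3 = balanced-3-or-configuration x deg≡3
    balanced-or-configuration x 4 _     = inj₂ (balanced-4 x)
    balanced-or-configuration x 5 deg≡5 = inj₂ (balanced-medium x 5 deg≡5 fromMedium≤2 (m≤m+n 70 20))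
    balanced-or-configuration x 6 deg≡6 = inj₂ (balanced-medium x 6 deg≡6 fromMedium≤2 (m≤m+n 72 36))
    balanced-or-configuration x 7 deg≡7 = balanced-7-9-or-C1-4 x 0 deg≡7 z≤n
    balanced-or-configuration x 8 deg≡8 = balanced-7-9-or-C1-4 x 1 deg≡8 (s≤s z≤n)
    balanced-or-configuration x 9 deg≡9 = balanced-7-9-or-C1-4 x 2 deg≡9 (s≤s (s≤s z≤n))
    balanced-or-configuration x d@(suc (suc (suc (suc (suc (suc (suc (suc (suc (suc k)))))))))) deg≡d =
      inj₂ (balanced-large x d deg≡d (budget-10 k _ (subst (#deg2Neighbours G x ≤_) deg≡d (#deg2Neighbours≤degree x))))

  vertices-sparse : (∀ x → Balanced x (degree G x)) → 5 * n G ≤ 3 * #edges G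
  vertices-sparse balanced = *-cancelˡ-≤ 12 (begin
    12 * (5 * n G)         ≡⟨ trans (sym (*-assoc 12 5 (n G))) (*-comm 60 (n G)) ⟩
    n G * 60               ≡⟨ sumF-const {n G} 60 ⟨
    sumF {n G} (λ _ → 60)  ≤⟨ +-cancelʳ-≤ S _ _ totals ⟩
    18 * sumF (degree G)   ≡⟨ cong (18 *_) (handshake G) ⟩
    18 * (2 * #edges G)    ≡⟨ trans (sym (*-assoc 18 2 (#edges G))) (*-assoc 12 3 (#edges G)) ⟩
    12 * (3 * #edges G)    ∎)
    where
    open ≤-Reasoning
    out : Vertex G → ℕ
    out x = sentBy x (degree G x)
    S : ℕ
    S = sumF out
    totals : sumF {n G} (λ _ → 60) + S ≤ 18 * sumF (degree G) + S
    totals = begin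
      sumF {n G} (λ _ → 60) + S
        ≡⟨ sumF-+ (λ _ → 60) out ⟨
      sumF (λ x → 60 + out x)
        ≤⟨ sumF-mono balanced ⟩
      sumF (λ x → 18 * degree G x + receivedBy x (degree G x))
        ≡⟨ sumF-+ (λ x → 18 * degree G x) (λ x → receivedBy x (degree G x)) ⟩
      sumF (λ x → 18 * degree G x) + sumF (λ x → receivedBy x (degree G x))
        ≡⟨ cong₂ _+_ (sumF-* 18 (degree G)) (sym (sumNbr-comm (λ x y → transfer (degree G x) (degree G y)))) ⟩
      18 * sumF (degree G) + S
        ∎

minimum-degree-or-C1-1 : (G : Graph) → C1-1 G ⊎ (∀ x → 2 ≤ degree G x)
minimum-degree-or-C1-1 G = ∀⊎ decide
  where
  decide : ∀ x → C1-1 G ⊎ 2 ≤ degree G x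
  decide x with degree G x ≤? 1
  ... | yes ≤1 = inj₁ (x , ≤1)
  ... | no  ≰1 = inj₂ (≰⇒> ≰1)

euler-lower-bound : ∀ G (ρ : RotationSystem G) → IsPlanarEmbedding G ρ → 1 ≤ n G →
                    (∀ x → 2 ≤ degree G x) → #edges G + 2 ≤ n G + #faces ρ
euler-lower-bound G ρ euler 1≤n δ≥2 = begin
  #edges G + 2                       ≤⟨ +-monoʳ-≤ (#edges G) (*-monoʳ-≤ 2 (#components-pos G 1≤n)) ⟩
  #edges G + 2 * #components G       ≡⟨ euler ⟨
  n G + #faces ρ + #isolated G       ≡⟨ cong (n G + #faces ρ +_) (#isolated≡0 G δ≥2) ⟩
  n G + #faces ρ + 0                 ≡⟨ +-identityʳ _ ⟩
  n G + #faces ρ                     ∎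
  where open ≤-Reasoning

euler-contradiction : ∀ v e f → e + 2 ≤ v + f → 5 * v ≤ 3 * e → 5 * f ≤ 2 * e → ⊥
euler-contradiction v e f e+2≤v+f 5v≤3e 5f≤2e = m+1+n≰m (5 * e) (begin
  5 * e + 10        ≡⟨ *-distribˡ-+ 5 e 2 ⟨
  5 * (e + 2)       ≤⟨ *-monoʳ-≤ 5 e+2≤v+f ⟩
  5 * (v + f)       ≡⟨ *-distribˡ-+ 5 v f ⟩
  5 * v + 5 * f     ≤⟨ +-mono-≤ 5v≤3e 5f≤2e ⟩
  3 * e + 2 * e     ≡⟨ *-distribʳ-+ e 3 2 ⟨
  5 * e             ∎)
  where open ≤-Reasoning

corollary3p3 : (G : Graph) → 1 ≤ n G → Planar G → GirthAtLeast5 G →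
    C1-1 G ⊎ C1-2 G ⊎ C1-3 G ⊎ C1-4 G
corollary3p3 G 1≤n (ρ , euler) girth≥5 with minimum-degree-or-C1-1 G
... | inj₁ c1-1 = inj₁ c1-1
... | inj₂ δ≥2 with ∀⊎ (λ x → Discharging.balanced-or-configuration G δ≥2 x (degree G x) refl)
... | inj₁ configuration = configuration
... | inj₂ balanced = ⊥-elim (euler-contradiction (n G) (#edges G) (#faces ρ)
  (euler-lower-bound G ρ euler 1≤n δ≥2)
  (Discharging.vertices-sparse G balanced)
  (Faces.faces-sparse G ρ δ≥2 girth≥5))
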